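{- Let $G$ be an undirected graph (loops allowed) that generates a fusion ring, and let $C$ be a connected component of $G$ with at least two vertices that contains no self-loops. Then for every vertex $v\in C$, the subgraph of $C$ induced on the neighbourhood $N(v)$ has minimum degree at least $2$.
   Context: A fusion ring of rank $r$ (commutative) is a commutative unital ring, free as a $\mathbb{Z}$-module on a basis $X_0=1,X_1,\dots,X_{r-1}$, with $X_iX_j=\sum_k N_{ij}^kX_k$, $N_{ij}^k\in\mathbb{Z}_{\ge0}$, and an involution $i\mapsto i^*$ with $N_{ij}^0=\delta_{i,j^*}$ and $N_{ij}^k=N_{jk^*}^{i^*}=N_{j^*i^*}^{k^*}$. It is self-dual if $i^*=i$ for all $i$, multiplicity-free if all $N_{ij}^k\in\{0,1\}$. For such a self-dual multiplicity-free ring its associated digraph $D$ on $\{1,\dots,r-1\}$ has a loop at $i$ iff $N_{ii}^i=1$ and, for $i\ne j$, an arc $(i,j)$ iff $N_{ii}^j=1$; its associated $3$-uniform hypergraph $H$ has hyperedge $\{i,j,k\}$ (distinct) iff $N_{ij}^k=1$. A digraph $D$ generates a fusion ring if for some $H$ the pair $(D,H)$ is the associated pair of a self-dual multiplicity-free fusion ring. An undirected graph (possibly with loops) is identified with the digraph having arcs $(i,j),(j,i)$ for each edge $\{i,j\}$, $i\ne j$. $N(v)$ denotes the set of vertices adjacent to $v$. -}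

module Defs where

open import Data.Nat using (ℕ; zero; suc; _+_; _*_; _≤_)
open import Data.Fin using (Fin; zero; suc; _≟_)
open import Data.Bool using (Bool; true; false; if_then_else_; _∧_)
open import Data.List using (List; length; filter)
open import Data.List using () renaming (allFin to allFinL)
open import Data.Product using (Σ; ∃; _×_; _,_)
open import Relation.Nullary using (¬_)
open import Relation.Nullary.Decidable using (⌊_⌋)
open import Relation.Binary.PropositionalEquality using (_≡_; _≢_)
open import Relation.Binary.Construct.Closure.ReflexiveTransitive using (Star)
open import Function.Bundles using (_⇔_)
import Data.Bool as B

∑ : {n : ℕ} → (Fin n → ℕ) → ℕ
∑ {zero}  f = 0
∑ {suc n} f = f zero + ∑ (λ i → f (suc i))

δ : {n : ℕ} → Fin n → Fin n → ℕ
δ i j = if ⌊ i ≟ j ⌋ then 1 else 0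

-- A commutative fusion ring of rank r = suc n, given by its structure
-- constants N i j k = N_{ij}^k on the basis X_0 = 1, X_1, ..., X_n
-- (index zero ∈ Fin (suc n) is X_0 = 1), and the involution i ↦ i*.
record FusionRing (n : ℕ) : Set where
  field
    N          : Fin (suc n) → Fin (suc n) → Fin (suc n) → ℕ
    dual       : Fin (suc n) → Fin (suc n)
    dual-invol : ∀ i → dual (dual i) ≡ i
    unitˡ      : ∀ j k → N zero j k ≡ δ j k
    unitʳ      : ∀ j k → N j zero k ≡ δ j k
    comm       : ∀ i j k → N i j k ≡ N j i k
    assoc      : ∀ i j k l →
                 ∑ (λ m → N i j m * N m k l) ≡ ∑ (λ m → N j k m * N i m l)
    N-zero     : ∀ i j → N i j zero ≡ δ i (dual j)
    frob₁      : ∀ i j k → N i j k ≡ N j (dual k) (dual i)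
    frob₂      : ∀ i j k → N i j k ≡ N (dual j) (dual i) (dual k)

open FusionRing public

SelfDual : {n : ℕ} → FusionRing n → Set
SelfDual R = ∀ i → dual R i ≡ i

MultiplicityFree : {n : ℕ} → FusionRing n → Set
MultiplicityFree R = ∀ i j k → N R i j k ≤ 1

record Graph (n : ℕ) : Set where
  field
    E     : Fin n → Fin n → Bool
    E-sym : ∀ u v → E u v ≡ E v u

open Graph public

Adj : {n : ℕ} → Graph n → Fin n → Fin n → Set
Adj G u v = E G u v ≡ true

-- G generates a fusion ring: there is a self-dual multiplicity-free
-- fusion ring of rank n+1 whose associated digraph is (the digraph of) G,
-- with vertex v ∈ Fin n corresponding to basis index suc v.  Loop at v iff
-- N_{vv}^v = 1, and for v ≠ w an arc (v,w) iff N_{vv}^w = 1; both cases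
-- are captured uniformly by N_{vv}^w = 1 ⇔ E v w.  (The hypergraph H is
-- then determined by the ring, so "for some H" is automatic.)
GeneratesFusionRing : {n : ℕ} → Graph n → Set
GeneratesFusionRing {n} G =
  Σ (FusionRing n) λ R →
    SelfDual R × MultiplicityFree R ×
    (∀ v w → (N R (suc v) (suc v) (suc w) ≡ 1) ⇔ Adj G v w)

Connected : {n : ℕ} → Graph n → Fin n → Fin n → Set
Connected G = Star (Adj G)

inducedDegree : {n : ℕ} → Graph n → (Fin n → Bool) → Fin n → ℕ
inducedDegree {n} G S u = length (filter (λ w → (S w ∧ E G u w) B.≟ true) (allFinL n))

-- Self-duality and multiplicity-freeness make N_{ij}^k a 0/1 value symmetric in
-- i, j, k, so associativity for X_v X_v X_u X_u, i.e. ⟨X_v², X_u²⟩ = ‖X_v X_u‖²,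
-- reads 1 + #(common neighbours of v and u) = ∑_m N_{vu}^m.  For an edge v – u
-- with no loops at v and u, X_v and X_u both occur in X_v X_u, so there is a
-- common neighbour w.  If X_v X_u were just X_v + X_u, associativity for
-- X_u X_u X_v X_w would have two nonzero terms on one side and at most one on
-- the other; hence a third constituent, i.e. a second common neighbour.
module Submission where

open import Defs
open import Data.Nat using (ℕ; zero; suc; _+_; _*_; _≤_; _<_; z≤n; s≤s; _≤?_)
open import Data.Nat.Properties
  using (+-identityʳ; *-identityʳ; *-zeroʳ; m≤m+n; +-monoʳ-≤; ≤-pred;
         ≰⇒>; ≤⇒≯; ≤∧≢⇒<; n<1⇒n≡0; +-commutativeSemigroup)
open import Algebra.Properties.CommutativeSemigroup +-commutativeSemigroup using (x∙yz≈y∙xz)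
open import Data.Fin as Fin using (Fin; zero; suc; _≟_)
open import Data.Fin.Properties using (suc-injective)
open import Data.Bool using (Bool; true; false; if_then_else_; _∧_)
open import Data.List using (length; filter; tabulate)
open import Data.Product using (Σ; ∃; _×_; _,_)
open import Data.Empty using (⊥-elim)
open import Relation.Nullary using (¬_; yes; no; does)
open import Relation.Binary.PropositionalEquality
open import Relation.Binary.Construct.Closure.ReflexiveTransitive using (ε; _◅_; _◅◅_)
open import Function using (_∘_; id; case_of_)
open import Function.Bundles using (_⇔_; Equivalence)
import Data.Bool as B

∑-cong : {n : ℕ} {f g : Fin n → ℕ} → (∀ i → f i ≡ g i) → ∑ f ≡ ∑ g
∑-cong {zero}  eq = refl
∑-cong {suc n} eq = cong₂ _+_ (eq zero) (∑-cong (λ i → eq (suc i)))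

except : {n : ℕ} → Fin n → (Fin n → ℕ) → Fin n → ℕ
except a f i = if does (i ≟ a) then 0 else f i

except-≢ : {n : ℕ} (f : Fin n → ℕ) {a b : Fin n} → b ≢ a → except a f b ≡ f b
except-≢ f {a} {b} b≢a with b ≟ a
... | yes b≡a = ⊥-elim (b≢a b≡a)
... | no _    = refl

∑-except : {n : ℕ} (f : Fin n → ℕ) (a : Fin n) → ∑ f ≡ f a + ∑ (except a f)
∑-except {suc n} f zero    = refl
∑-except {suc n} f (suc a) = begin
  f zero + ∑ (f ∘ suc)                           ≡⟨ cong (f zero +_) (∑-except (f ∘ suc) a) ⟩
  f zero + (f (suc a) + ∑ (except a (f ∘ suc)))  ≡⟨ x∙yz≈y∙xz (f zero) (f (suc a)) _ ⟩
  f (suc a) + (f zero + ∑ (except a (f ∘ suc)))  ∎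
  where open ≡-Reasoning

∑-≥-point : {n : ℕ} (f : Fin n → ℕ) (a : Fin n) → f a ≤ ∑ f
∑-≥-point f a rewrite ∑-except f a = m≤m+n (f a) _

∑-≥-pair : {n : ℕ} (f : Fin n → ℕ) {a b : Fin n} → b ≢ a → f a + f b ≤ ∑ f
∑-≥-pair f {a} {b} b≢a rewrite ∑-except f a =
  +-monoʳ-≤ (f a) (subst (_≤ ∑ (except a f)) (except-≢ f b≢a) (∑-≥-point (except a f) b))

∑-≥-triple : {n : ℕ} (f : Fin n → ℕ) {a b c : Fin n} → b ≢ a → c ≢ a → c ≢ b →
             f a + (f b + f c) ≤ ∑ f
∑-≥-triple f {a} {b} {c} b≢a c≢a c≢b rewrite ∑-except f a =
  +-monoʳ-≤ (f a)
    (subst₂ (λ x y → x + y ≤ ∑ (except a f)) (except-≢ f b≢a) (except-≢ f c≢a)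
      (∑-≥-pair (except a f) c≢b))

∑-zero : {n : ℕ} (f : Fin n → ℕ) → (∀ i → f i ≡ 0) → ∑ f ≡ 0
∑-zero {zero}  f f≡0 = refl
∑-zero {suc n} f f≡0 rewrite f≡0 zero = ∑-zero (λ i → f (suc i)) (λ i → f≡0 (suc i))

∑-concentrated : {n : ℕ} (f : Fin n → ℕ) (a : Fin n) → (∀ i → i ≢ a → f i ≡ 0) → ∑ f ≡ f a
∑-concentrated f a vanish = begin
  ∑ f                      ≡⟨ ∑-except f a ⟩
  f a + ∑ (except a f)     ≡⟨ cong (f a +_) (∑-zero (except a f) except≡0) ⟩
  f a + 0                  ≡⟨ +-identityʳ (f a) ⟩
  f a                      ∎
  where
  open ≡-Reasoning
  except≡0 : ∀ i → except a f i ≡ 0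
  except≡0 i with i ≟ a
  ... | yes _   = refl
  ... | no i≢a = vanish i i≢a

∑-positive⇒∃-positive : {n : ℕ} (f : Fin n → ℕ) → 0 < ∑ f → ∃ λ i → 0 < f i
∑-positive⇒∃-positive {suc n} f 0<∑ with f zero in eq
... | suc _ = zero , subst (0 <_) (sym eq) (s≤s z≤n)
... | zero  = let (i , 0<fi) = ∑-positive⇒∃-positive (λ i → f (suc i)) 0<∑ in suc i , 0<fi

length-filter-tabulate : {A : Set} {n : ℕ} (P : A → Bool) (g : Fin n → A) →
  length (filter (λ x → P x B.≟ true) (tabulate g)) ≡ ∑ (λ i → if P (g i) then 1 else 0)
length-filter-tabulate {n = zero}  P g = refl
length-filter-tabulate {n = suc n} P g with P (g zero)
... | true  = cong suc (length-filter-tabulate P (λ i → g (suc i)))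
... | false = length-filter-tabulate P (λ i → g (suc i))

δ-diag : {n : ℕ} (i : Fin n) → δ i i ≡ 1
δ-diag i with i ≟ i
... | yes _   = refl
... | no i≢i = ⊥-elim (i≢i refl)

module SelfDualMultiplicityFree {n : ℕ} (R : FusionRing n) (self-dual : SelfDual R)
                                (mult-free : MultiplicityFree R) where

  Nᴿ : Fin (suc n) → Fin (suc n) → Fin (suc n) → ℕ
  Nᴿ = N R

  N-rotate : ∀ i j k → Nᴿ i j k ≡ Nᴿ j k i
  N-rotate i j k = trans (frob₁ R i j k) (cong₂ (Nᴿ j) (self-dual k) (self-dual i))

  N-swap : ∀ i j k → Nᴿ i j k ≡ Nᴿ i k j
  N-swap i j k = trans (sym (N-rotate k i j)) (comm R k i j)

  N-unit : ∀ j → Nᴿ zero j j ≡ 1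
  N-unit j = trans (unitˡ R j j) (δ-diag j)

  N-counit : ∀ i → Nᴿ i i zero ≡ 1
  N-counit i = trans (N-zero R i i) (trans (cong (δ i) (self-dual i)) (δ-diag i))

  N-≢1 : ∀ i j k → Nᴿ i j k ≢ 1 → Nᴿ i j k ≡ 0
  N-≢1 i j k ≢1 = n<1⇒n≡0 (≤∧≢⇒< (mult-free i j k) ≢1)

  N-idem : ∀ i j k → Nᴿ i j k * Nᴿ i j k ≡ Nᴿ i j k
  N-idem i j k with Nᴿ i j k | mult-free i j k
  ... | 0 | _         = refl
  ... | 1 | _         = refl
  ... | suc (suc _) | s≤s ()

  ∑-N-ii-jj≡∑-N-ij : ∀ i j → ∑ (λ m → Nᴿ i i m * Nᴿ m j j) ≡ ∑ (Nᴿ i j)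
  ∑-N-ii-jj≡∑-N-ij i j = trans (assoc R i i j j) (∑-cong square)
    where
    square : ∀ m → Nᴿ i j m * Nᴿ i m j ≡ Nᴿ i j m
    square m = trans (cong (Nᴿ i j m *_) (N-swap i m j)) (N-idem i j m)

  Arc : Fin (suc n) → Fin (suc n) → Set
  Arc i j = Nᴿ i i j ≡ 1

  arcs⇒2≤∑N : ∀ {i j} → j ≢ i → Arc i j → Arc j i → 2 ≤ ∑ (Nᴿ i j)
  arcs⇒2≤∑N {i} {j} j≢i ij ji =
    subst₂ (λ x y → x + y ≤ ∑ (Nᴿ i j))
      (trans (N-swap i j i) ij) (trans (N-rotate i j j) ji)
      (∑-≥-pair (Nᴿ i j) j≢i)

  ∑N≤2⇒N≡0 : ∀ {i j m} → j ≢ i → Arc i j → Arc j i → ∑ (Nᴿ i j) ≤ 2 →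
             m ≢ i → m ≢ j → Nᴿ i j m ≡ 0
  ∑N≤2⇒N≡0 {i} {j} {m} j≢i ij ji ∑≤2 m≢i m≢j = N-≢1 i j m λ ≡1 →
    ≤⇒≯ ∑≤2
      (subst₂ (λ x y → x + (y + 1) ≤ ∑ (Nᴿ i j))
        (trans (N-swap i j i) ij) (trans (N-rotate i j j) ji)
        (subst (λ z → Nᴿ i j i + (Nᴿ i j j + z) ≤ ∑ (Nᴿ i j)) ≡1
          (∑-≥-triple (Nᴿ i j) j≢i m≢i m≢j)))

  triangle⇒3≤∑N : ∀ {i j k} → j ≢ i → k ≢ i → k ≢ j →
                  Arc i j → Arc j i → Arc i k → Arc j k → Arc k i → 3 ≤ ∑ (Nᴿ i j)
  triangle⇒3≤∑N {i} {j} {k} j≢i k≢i k≢j ij ji ik jk ki with 3 ≤? ∑ (Nᴿ i j)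
  ... | yes 3≤∑ = 3≤∑
  ... | no  3≰∑ = ⊥-elim (≤⇒≯ (subst (_≤ 1) (sym (assoc R j j i k)) right≤1) left≥2)
    where
    ∑≤2 : ∑ (Nᴿ i j) ≤ 2
    ∑≤2 = ≤-pred (≰⇒> 3≰∑)

    Nij≡0 : ∀ {m} → m ≢ i → m ≢ j → Nᴿ i j m ≡ 0
    Nij≡0 = ∑N≤2⇒N≡0 j≢i ij ji ∑≤2

    left≥2 : 2 ≤ ∑ (λ m → Nᴿ j j m * Nᴿ m i k)
    left≥2 = subst₂ (λ x y → x + y ≤ ∑ (λ m → Nᴿ j j m * Nᴿ m i k))
      (cong₂ _*_ ji ik) (cong₂ _*_ jk (trans (N-swap k i k) ki))
      (∑-≥-pair (λ m → Nᴿ j j m * Nᴿ m i k) k≢i)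

    right-off-j : ∀ m → m ≢ j → Nᴿ j i m * Nᴿ j m k ≡ 0
    right-off-j m m≢j with m ≟ i
    ... | yes refl =
      trans (cong (Nᴿ j i i *_) (trans (comm R j i k) (Nij≡0 k≢i k≢j))) (*-zeroʳ (Nᴿ j i i))
    ... | no m≢i   = cong (_* Nᴿ j m k) (trans (comm R j i m) (Nij≡0 m≢i m≢j))

    right≤1 : ∑ (λ m → Nᴿ j i m * Nᴿ j m k) ≤ 1
    right≤1 rewrite ∑-concentrated (λ m → Nᴿ j i m * Nᴿ j m k) j right-off-j
                  | jk | *-identityʳ (Nᴿ j i j) = mult-free j i j

indicator-∧ : ∀ a b → (if a then 1 else 0) * (if b then 1 else 0) ≡ (if a ∧ b then 1 else 0)
indicator-∧ true  true  = refl
indicator-∧ true  false = refl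
indicator-∧ false _     = refl

module _ {n : ℕ} (G : Graph n) where

  Adj-sym : ∀ {a b} → Adj G a b → Adj G b a
  Adj-sym {a} {b} ab = trans (E-sym G b a) ab

  loopless-Adj⇒≢ : ∀ {a b} → ¬ Adj G a a → Adj G a b → b ≢ a
  loopless-Adj⇒≢ {a} ¬aa ab b≡a = ¬aa (subst (Adj G a) b≡a ab)

  commonNeighbours : Fin n → Fin n → ℕ
  commonNeighbours v u = ∑ (λ w → if E G v w ∧ E G u w then 1 else 0)

  inducedDegree-neighbourhood : ∀ v u → inducedDegree G (E G v) u ≡ commonNeighbours v u
  inducedDegree-neighbourhood v u = length-filter-tabulate (λ w → E G v w ∧ E G u w) id

  positive⇒∃-commonNeighbour : ∀ {v u} → 0 < commonNeighbours v u →
                               ∃ λ w → Adj G v w × Adj G u w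
  positive⇒∃-commonNeighbour {v} {u} 0<common
    with ∑-positive⇒∃-positive (λ w → if E G v w ∧ E G u w then 1 else 0) 0<common
  ... | w , 0<ind with E G v w in vw | E G u w in uw
  ...   | true | true = w , vw , uw

module Realisation {n : ℕ} (G : Graph n) (R : FusionRing n)
                   (self-dual : SelfDual R) (mult-free : MultiplicityFree R)
                   (realises : ∀ v w → (N R (suc v) (suc v) (suc w) ≡ 1) ⇔ Adj G v w) where

  open SelfDualMultiplicityFree R self-dual mult-free

  Adj⇒Arc : ∀ {v w} → Adj G v w → Arc (suc v) (suc w)
  Adj⇒Arc {v} {w} = Equivalence.from (realises v w)

  N-indicator : ∀ v w → Nᴿ (suc v) (suc v) (suc w) ≡ (if E G v w then 1 else 0)
  N-indicator v w with E G v w in vw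
  ... | true  = Adj⇒Arc vw
  ... | false = N-≢1 _ _ _ λ ≡1 → case trans (sym vw) (Equivalence.to (realises v w) ≡1) of λ ()

  suc-commonNeighbours≡∑N : ∀ v u → suc (commonNeighbours G v u) ≡ ∑ (Nᴿ (suc v) (suc u))
  suc-commonNeighbours≡∑N v u = begin
    1 + commonNeighbours G v u
      ≡⟨ cong₂ _+_ (sym (cong₂ _*_ (N-counit V) (N-unit U))) (sym (∑-cong common)) ⟩
    ∑ (λ m → Nᴿ V V m * Nᴿ m U U)
      ≡⟨ ∑-N-ii-jj≡∑-N-ij V U ⟩
    ∑ (Nᴿ V U) ∎
    where
    open ≡-Reasoning
    V U : Fin (suc n)
    V = suc v
    U = suc u
    common : ∀ w → Nᴿ V V (suc w) * Nᴿ (suc w) U U ≡ (if E G v w ∧ E G u w then 1 else 0)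
    common w = begin
      Nᴿ V V (suc w) * Nᴿ (suc w) U U  ≡⟨ cong (Nᴿ V V (suc w) *_) (N-rotate (suc w) U U) ⟩
      Nᴿ V V (suc w) * Nᴿ U U (suc w)  ≡⟨ cong₂ _*_ (N-indicator v w) (N-indicator u w) ⟩
      _                                ≡⟨ indicator-∧ (E G v w) (E G u w) ⟩
      _                                ∎

  edge⇒∃-commonNeighbour : ∀ {v u} → u ≢ v → Adj G v u → ∃ λ w → Adj G v w × Adj G u w
  edge⇒∃-commonNeighbour {v} {u} u≢v vu =
    positive⇒∃-commonNeighbour G (≤-pred (subst (2 ≤_) (sym (suc-commonNeighbours≡∑N v u))
      (arcs⇒2≤∑N (u≢v ∘ suc-injective) (Adj⇒Arc vu) (Adj⇒Arc (Adj-sym G vu)))))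

  loopless-edge⇒2≤commonNeighbours : ∀ {v u} → ¬ Adj G v v → ¬ Adj G u u → Adj G v u →
                                      2 ≤ commonNeighbours G v u
  loopless-edge⇒2≤commonNeighbours {v} {u} ¬vv ¬uu vu
    with edge⇒∃-commonNeighbour (loopless-Adj⇒≢ G ¬vv vu) vu
  ... | w , vw , uw =
    ≤-pred (subst (3 ≤_) (sym (suc-commonNeighbours≡∑N v u))
      (triangle⇒3≤∑N (distinct ¬vv vu) (distinct ¬vv vw) (distinct ¬uu uw)
        (Adj⇒Arc vu) (Adj⇒Arc (Adj-sym G vu)) (Adj⇒Arc vw) (Adj⇒Arc uw) (Adj⇒Arc (Adj-sym G vw))))
    where
    distinct : ∀ {a b} → ¬ Adj G a a → Adj G a b → Fin.suc b ≢ suc a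
    distinct ¬aa ab = loopless-Adj⇒≢ G ¬aa ab ∘ suc-injective

-- The hypothesis that the component has a second vertex is implied by the edge v – u.
mainTheorem4 : (n : ℕ) (G : Graph n) → GeneratesFusionRing G →
    (c : Fin n) →
    Σ (Fin n) (λ w → Connected G c w × w ≢ c) →
    ((w : Fin n) → Connected G c w → ¬ Adj G w w) →
    (v : Fin n) → Connected G c v →
    (u : Fin n) → Adj G v u →
    2 ≤ inducedDegree G (E G v) u
mainTheorem4 n G (R , self-dual , mult-free , realises) c _ loopless v c⋆v u vu =
  subst (2 ≤_) (sym (inducedDegree-neighbourhood G v u))
    (loopless-edge⇒2≤commonNeighbours (loopless v c⋆v) (loopless u (c⋆v ◅◅ vu ◅ ε)) vu)
  where open Realisation G R self-dual mult-free realises
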